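{- Assume the standing setting below. If $m\in[k_1+1,k_1+k_2]$, $i\in[-k_2,k_2]^{*}$, $j\in[-k_2,k_1]^{*}$, and both $m-i\le k_1+k_2$ and $m-j\le k_1+k_2$, then $\psi(m,i,j)=0$.
   Context: Standing setting: $k_1>k_2\ge 0$ and $n$ are integers, and $k_1+k_2+1$ is composite. $G$ is a finite abelian group written multiplicatively with identity $e$, of order $1+n(k_1+k_2)+\binom{n}{2}(k_1+k_2)^2$, and $T=\{t_1,\dots,t_n\}\subset G$ has $|T|=n$. Notation: for integers $a<b$, $[a,b]^{*}=\{i\ne 0: a\le i\le b\}$; $I=[-k_2,k_1]^{*}$; for an integer $i$, $T^{(i)}=\{t^i:t\in T\}$; for integers $i,j$, $S(i,j)=\{g^ih^j: g,h\in T,\ g\ne h\}$. It is assumed that $G$ is the disjoint union $\{e\}\cup\bigcup_{i\in I}T^{(i)}\cup\bigcup_{i,j\in I,\,i\le j}S(i,j)$; equivalently, in $\mathbb{Z}[G]$, $\sum_{g\in G}g=e+\sum_{i=1}^n\sum_{j\in I}t_i^j+\sum_{1\le i<j\le n}(\sum_{k\in I}t_i^k)(\sum_{l\in I}t_j^l)$. Counting function: $\psi(m,i,j)=|\{t\in T: t^m\in S(i,j)\}|$. -}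

module Defs where

open import Level using (Level; _⊔_)
open import Algebra.Bundles using (AbelianGroup)
open import Data.Nat using (ℕ; zero; suc)
import Data.Nat as ℕ
open import Data.Nat.Combinatorics using (_C_)
open import Data.Integer using (ℤ; +_; -[1+_]; _≤_; -_)
open import Data.Fin using (Fin)
open import Data.Product using (Σ; ∃; _×_)
open import Data.Sum using (_⊎_)
open import Relation.Binary.PropositionalEquality using (_≡_; _≢_)
open import Relation.Nullary using (¬_)

groupOrder : ℕ → ℕ → ℕ → ℕ
groupOrder k₁ k₂ n =
  1 ℕ.+ n ℕ.* (k₁ ℕ.+ k₂) ℕ.+ (n C 2) ℕ.* ((k₁ ℕ.+ k₂) ℕ.* (k₁ ℕ.+ k₂))

_∈[_,_]* : ℤ → ℤ → ℤ → Set
i ∈[ a , b ]* = (i ≢ + 0) × (a ≤ i) × (i ≤ b)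

InI : ℕ → ℕ → ℤ → Set
InI k₁ k₂ i = i ∈[ - (+ k₂) , + k₁ ]*

module Powers {c ℓ : Level} (G : AbelianGroup c ℓ) where
  open AbelianGroup G

  powℕ : Carrier → ℕ → Carrier
  powℕ g zero    = ε
  powℕ g (suc n) = g ∙ powℕ g n

  _^_ : Carrier → ℤ → Carrier
  g ^ (+ n)      = powℕ g n
  g ^ (-[1+ n ]) = (powℕ g (suc n)) ⁻¹

module Code {c ℓ : Level} (G : AbelianGroup c ℓ) {n : ℕ} (t : Fin n → AbelianGroup.Carrier G) where
  open AbelianGroup G
  open Powers G

  -- x ∈ S(i,j) = { g^i h^j : g,h ∈ T, g ≠ h }, T = { t a : a : Fin n } with t injective
  InS : ℤ → ℤ → Carrier → Set ℓ
  InS i j x = ∃ λ a → ∃ λ b → (a ≢ b) × (x ≈ (t a ^ i) ∙ (t b ^ j))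

  record IsDisjointUnion (k₁ k₂ : ℕ) : Set (c ⊔ ℓ) where
    field
      cover : ∀ x →
        (x ≈ ε)
        ⊎ (∃ λ a → ∃ λ i → InI k₁ k₂ i × (x ≈ t a ^ i))
        ⊎ (∃ λ i → ∃ λ j → InI k₁ k₂ i × InI k₁ k₂ j × (i ≤ j) × InS i j x)
      e∉T : ∀ a i → InI k₁ k₂ i → ¬ (ε ≈ t a ^ i)
      e∉S : ∀ i j → InI k₁ k₂ i → InI k₁ k₂ j → i ≤ j → ¬ InS i j ε
      T∩T : ∀ a a' i i' → InI k₁ k₂ i → InI k₁ k₂ i' → i ≢ i' →
            ¬ (t a ^ i ≈ t a' ^ i')
      T∩S : ∀ a i j k → InI k₁ k₂ i → InI k₁ k₂ j → InI k₁ k₂ k → j ≤ k →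
            ¬ InS j k (t a ^ i)
      S∩S : ∀ i j i' j' x → InI k₁ k₂ i → InI k₁ k₂ j → i ≤ j →
            InI k₁ k₂ i' → InI k₁ k₂ j' → i' ≤ j' →
            InS i j x → InS i' j' x → (i ≡ i') × (j ≡ j')

{-# OPTIONS --safe #-}
-- Suppose t_a^m = t_b^i t_c^j with b ≠ c, and put r = k₁ - m ∈ [-k₂, -1], so that
-- t_a^k₁ = t_a^r t_b^i t_c^j.  If a = b, the right-hand side is t_a^(r+i) t_c^j with
-- r + i ∈ [-k₂, k₁], an element of T or S written differently from t_a^k₁; a = c is
-- symmetric; otherwise t_a^k₁ t_b^(-i) = t_a^r t_c^j are two representations of one
-- element of S on different pairs of generators.  Representations are unique because
-- there are exactly |G| of them and every element of G has one, so the evaluation map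
-- is a surjection between sets of equal size.
module Submission where

open import Defs
open import Level using (Level)
open import Algebra.Bundles using (AbelianGroup)
open import Function.Base using (_∘_)
open import Function.Bundles using (Bijection; Inverse; _↔_)
open import Function.Definitions using (Injective)
open import Function.Properties.Inverse using (↔-refl; ↔-trans)
open import Data.Nat using (ℕ; _<_; zero; suc)
import Data.Nat as ℕ
import Data.Nat.Properties as ℕ
open import Data.Nat.Combinatorics using (_C_; nC1≡n; nCk+nC[k+1]≡[n+1]C[k+1])
open import Data.Nat.Primality using (Composite)
open import Data.Integer using (ℤ; +_; -[1+_]; +[1+_]; -_; _+_; _-_; _≤_; +≤+; -≤+; -1ℤ)
import Data.Integer.Properties as ℤ
open import Data.Integer.Tactic.RingSolver using (solve-∀)
open import Data.Fin using (Fin; zero; suc; toℕ; fromℕ<; splitAt; punchOut)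
import Data.Fin as Fin
import Data.Fin.Properties as Fin
open import Data.Product using (∃; _×_; _,_; proj₁; proj₂; uncurry)
import Data.Product as Product
open import Data.Product.Function.NonDependent.Propositional using (_×-↔_)
open import Data.Sum using (_⊎_; inj₁; inj₂; [_,_])
open import Data.Sum.Function.Propositional using (_⊎-↔_)
open import Data.Unit using (⊤; tt)
open import Data.Empty using (⊥-elim)
open import Relation.Binary.Bundles using (Setoid)
open import Relation.Binary.PropositionalEquality using (_≡_; _≢_; refl; setoid)
import Relation.Binary.PropositionalEquality as ≡
open import Relation.Nullary using (¬_; yes; no; contradiction)

private
  variable
    X Y Z : Set
    k k₁ k₂ n : ℕ
    a a′ b b′ d i j m p x : ℤ

to-preimage : (X↔Y : X ↔ Y) (f : Y → Z) {z : Z} →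
  ∃ (λ y → f y ≡ z) → ∃ λ x → f (Inverse.to X↔Y x) ≡ z
to-preimage X↔Y f (y , fy≡z) =
  Inverse.from X↔Y y , ≡.trans (≡.cong f (Inverse.strictlyInverseˡ X↔Y y)) fy≡z

module _ {c ℓ : Level} (S : Setoid c ℓ) where
  open Setoid S using (Carrier; _≈_; sym; trans)

  surjective⇒injective : ∀ {N} → Bijection (setoid (Fin N)) S →
    (F : Fin N → Carrier) → (∀ x → ∃ λ y → F y ≈ x) →
    ∀ {y₁ y₂} → F y₁ ≈ F y₂ → y₁ ≡ y₂
  surjective⇒injective {zero} _ _ _ {()}
  surjective⇒injective {suc N} size F surj {y₁} {y₂} Fy₁≈Fy₂ with y₁ Fin.≟ y₂
  ... | yes y₁≡y₂ = y₁≡y₂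
  ... | no y₁≢y₂ = ⊥-elim (Fin.<⇒notInjective (ℕ.n<1+n N) squeeze-injective)
    where
    open Bijection size using (to; injective)

    -- Preimages avoiding y₂ inject Fin (suc N) into Fin N.
    preimage-avoiding-y₂ : ∀ x → ∃ λ y → y₂ ≢ y × F y ≈ x
    preimage-avoiding-y₂ x with surj x
    ... | y , Fy≈x with y Fin.≟ y₂
    ...   | yes refl = y₁ , y₁≢y₂ ∘ ≡.sym , trans Fy₁≈Fy₂ Fy≈x
    ...   | no y≢y₂  = y , y≢y₂ ∘ ≡.sym , Fy≈x

    squeeze : Fin (suc N) → Fin N
    squeeze x = punchOut (proj₁ (proj₂ (preimage-avoiding-y₂ (to x))))

    squeeze-injective : Injective _≡_ _≡_ squeeze
    squeeze-injective {x} {x′} eq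
      with preimage-avoiding-y₂ (to x) | preimage-avoiding-y₂ (to x′)
    ... | y , y₂≢y , Fy≈x | y′ , y₂≢y′ , Fy′≈x′ with refl ← Fin.punchOut-injective y₂≢y y₂≢y′ eq =
      injective (trans (sym Fy≈x) Fy′≈x′)

infix 4 _∈[_,_]

_∈[_,_] : ℤ → ℤ → ℤ → Set
q ∈[ a , b ] = a ≤ q × q ≤ b

∈[]*-weaken : a′ ≤ a → b ≤ b′ → i ∈[ a , b ]* → i ∈[ a′ , b′ ]*
∈[]*-weaken a′≤a b≤b′ (i≢0 , a≤i , i≤b) = i≢0 , ℤ.≤-trans a′≤a a≤i , ℤ.≤-trans i≤b b≤b′

neg-∈[-k,k]* : i ∈[ - (+ k) , + k ]* → (- i) ∈[ - (+ k) , + k ]*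
neg-∈[-k,k]* {i = i} {k = k} (i≢0 , -k≤i , i≤k) =
  i≢0 ∘ ℤ.neg-injective {i} {+ 0} ,
  ℤ.neg-mono-≤ i≤k ,
  ≡.subst (- i ≤_) (ℤ.neg-involutive (+ k)) (ℤ.neg-mono-≤ -k≤i)

k₁∈I : k₂ < k₁ → InI k₁ k₂ (+ k₁)
k₁∈I k₂<k₁ = (λ { refl → ℕ.n≮0 k₂<k₁ }) , ℤ.neg-≤-pos , ℤ.≤-refl

[-k₂,k₂]*⊆I : k₂ < k₁ → i ∈[ - (+ k₂) , + k₂ ]* → InI k₁ k₂ i
[-k₂,k₂]*⊆I k₂<k₁ = ∈[]*-weaken ℤ.≤-refl (+≤+ (ℕ.<⇒≤ k₂<k₁))

k₁-d∈[-k₂,k₁] : + 0 ≤ d → d ≤ + (k₁ ℕ.+ k₂) → (+ k₁ - d) ∈[ - (+ k₂) , + k₁ ]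
k₁-d∈[-k₂,k₁] {d = d} {k₁ = k₁} {k₂ = k₂} 0≤d d≤k₁+k₂ =
  ≡.subst (_≤ + k₁ - d) (k-[k+l]≡-l (+ k₁) (+ k₂)) (ℤ.+-monoʳ-≤ (+ k₁) (ℤ.neg-mono-≤ d≤k₁+k₂)) ,
  ≡.subst (+ k₁ - d ≤_) (ℤ.+-identityʳ (+ k₁)) (ℤ.+-monoʳ-≤ (+ k₁) (ℤ.neg-mono-≤ 0≤d))
  where
  k-[k+l]≡-l : ∀ k l → k - (k + l) ≡ - l
  k-[k+l]≡-l = solve-∀

k₁-m∈I : + (k₁ ℕ.+ 1) ≤ m → m ≤ + (k₁ ℕ.+ k₂) → InI k₁ k₂ (+ k₁ - m)
k₁-m∈I {k₁ = k₁} {m = m} k₁+1≤m m≤k₁+k₂ =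
  (λ r≡0 → contradiction (≡.subst (_≤ -1ℤ) r≡0 r≤-1) λ ()) ,
  proj₁ (k₁-d∈[-k₂,k₁] (ℤ.≤-trans (+≤+ ℕ.z≤n) k₁+1≤m) m≤k₁+k₂) ,
  ℤ.≤-trans r≤-1 -≤+
  where
  k-[k+1]≡-1 : ∀ k → k - (k + + 1) ≡ -1ℤ
  k-[k+1]≡-1 = solve-∀

  r≤-1 : + k₁ - m ≤ -1ℤ
  r≤-1 = ≡.subst (+ k₁ - m ≤_) (k-[k+1]≡-1 (+ k₁)) (ℤ.+-monoʳ-≤ (+ k₁) (ℤ.neg-mono-≤ k₁+1≤m))

[k₁-m]+x∈[-k₂,k₁] : x ≤ m → m - x ≤ + (k₁ ℕ.+ k₂) → (+ k₁ - m) + x ∈[ - (+ k₂) , + k₁ ]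
[k₁-m]+x∈[-k₂,k₁] {x = x} {m = m} {k₁ = k₁} {k₂ = k₂} x≤m m-x≤k₁+k₂ =
  ≡.subst (_∈[ - (+ k₂) , + k₁ ]) (≡.sym ([k-m]+x≡k-[m-x] (+ k₁) m x))
    (k₁-d∈[-k₂,k₁] (ℤ.i≤j⇒0≤j-i x≤m) m-x≤k₁+k₂)
  where
  [k-m]+x≡k-[m-x] : ∀ k m x → (k - m) + x ≡ k - (m - x)
  [k-m]+x≡k-[m-x] = solve-∀

module _ (k₁ k₂ : ℕ) where

  private
    signedSuc : Fin k₁ ⊎ Fin k₂ → ℤ
    signedSuc = [ +[1+_] ∘ toℕ , -[1+_] ∘ toℕ ]

  exponent : Fin (k₁ ℕ.+ k₂) → ℤ
  exponent = signedSuc ∘ splitAt k₁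

  exponent-surjective : InI k₁ k₂ i → ∃ λ u → exponent u ≡ i
  exponent-surjective {+ zero} (0≢0 , _) = contradiction refl 0≢0
  exponent-surjective {+[1+ p ]} (_ , _ , +≤+ p<k₁) =
    to-preimage Fin.+↔⊎ signedSuc
      (inj₁ (fromℕ< p<k₁) , ≡.cong +[1+_] (Fin.toℕ-fromℕ< p<k₁))
  exponent-surjective { -[1+ p ]} (_ , -k₂≤i , _) =
    to-preimage Fin.+↔⊎ signedSuc
      (inj₂ (fromℕ< p<k₂) , ≡.cong -[1+_] (Fin.toℕ-fromℕ< p<k₂))
    where
    p<k₂ : p < k₂
    p<k₂ = ℤ.drop‿+≤+ (ℤ.neg-cancel-≤ -k₂≤i)

pascal-↔ : ∀ n → Fin (suc n C 2) ↔ (Fin n ⊎ Fin (n C 2))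
pascal-↔ n = ≡.subst (λ N → Fin N ↔ (Fin n ⊎ Fin (n C 2))) n+nC2≡[1+n]C2 Fin.+↔⊎
  where
  n+nC2≡[1+n]C2 : n ℕ.+ n C 2 ≡ suc n C 2
  n+nC2≡[1+n]C2 = ≡.trans (≡.cong (ℕ._+ n C 2) (≡.sym (nC1≡n n))) (nCk+nC[k+1]≡[n+1]C[k+1] n 1)

increasingPair : ∀ n → Fin (n C 2) → Fin n × Fin n
extendPair : ∀ n → Fin n ⊎ Fin (n C 2) → Fin (suc n) × Fin (suc n)

increasingPair zero    ()
increasingPair (suc n) = extendPair n ∘ Inverse.to (pascal-↔ n)

extendPair n (inj₁ b) = zero , suc b
extendPair n (inj₂ p) = Product.map suc suc (increasingPair n p)

increasingPair-surjective : ∀ {n} {a b : Fin n} → a Fin.< b → ∃ λ p → increasingPair n p ≡ (a , b)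
increasingPair-surjective {suc n} {zero} {suc b} _ =
  to-preimage (pascal-↔ n) (extendPair n) (inj₁ b , refl)
increasingPair-surjective {suc n} {suc a} {suc b} (ℕ.s≤s a<b) =
  let p , eq = increasingPair-surjective a<b in
  to-preimage (pascal-↔ n) (extendPair n) (inj₂ p , ≡.cong (Product.map suc suc) eq)

data Term (n : ℕ) : Set where
  unit    : Term n
  power   : Fin n → ℤ → Term n
  product : Fin n → Fin n → ℤ → ℤ → Term n

-- Products are normalised by ordering the generators (a < b), not the exponents as in the
-- paper's S(i,j) with i ≤ j; either way there are C(n,2)(k₁+k₂)² of them.
Canonical : ℕ → ℕ → Term n → Set
Canonical k₁ k₂ unit              = ⊤
Canonical k₁ k₂ (power a i)       = InI k₁ k₂ i
Canonical k₁ k₂ (product a b i j) = a Fin.< b × InI k₁ k₂ i × InI k₁ k₂ j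

sortedProduct : Fin n → Fin n → ℤ → ℤ → Term n
sortedProduct a b i j with a Fin.<? b
... | yes _ = product a b i j
... | no _  = product b a j i

sortedProduct-canonical : ∀ {a b : Fin n} → a ≢ b → InI k₁ k₂ i → InI k₁ k₂ j →
  Canonical k₁ k₂ (sortedProduct a b i j)
sortedProduct-canonical {a = a} {b = b} a≢b i∈I j∈I with a Fin.<? b
... | yes a<b = a<b , i∈I , j∈I
... | no a≮b  = Fin.≤∧≢⇒< (ℕ.≮⇒≥ a≮b) (a≢b ∘ ≡.sym) , j∈I , i∈I

sortedProduct-injective : ∀ {a b a′ b′ : Fin n} {i j i′ j′} →
  sortedProduct a b i j ≡ sortedProduct a′ b′ i′ j′ →
  (a ≡ a′ × b ≡ b′ × i ≡ i′ × j ≡ j′) ⊎ (a ≡ b′ × b ≡ a′ × i ≡ j′ × j ≡ i′)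
sortedProduct-injective {a = a} {b} {a′} {b′} eq with a Fin.<? b | a′ Fin.<? b′ | eq
... | yes _ | yes _ | refl = inj₁ (refl , refl , refl , refl)
... | yes _ | no _  | refl = inj₂ (refl , refl , refl , refl)
... | no _  | yes _ | refl = inj₂ (refl , refl , refl , refl)
... | no _  | no _  | refl = inj₁ (refl , refl , refl , refl)

module Coordinates (k₁ k₂ n : ℕ) where
  private
    K = k₁ ℕ.+ k₂

  Coordinate : Set
  Coordinate = (Fin 1 ⊎ Fin n × Fin K) ⊎ Fin (n C 2) × (Fin K × Fin K)

  coordinate-↔ : Fin (groupOrder k₁ k₂ n) ↔ Coordinate
  coordinate-↔ =
    ↔-trans (Fin.+↔⊎ {1 ℕ.+ n ℕ.* K})
      (↔-trans (Fin.+↔⊎ {1}) (↔-refl ⊎-↔ Fin.*↔×) ⊎-↔ ↔-trans (Fin.*↔× {n C 2}) (↔-refl ×-↔ Fin.*↔×))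

  decode : Coordinate → Term n
  decode (inj₁ (inj₁ _))       = unit
  decode (inj₁ (inj₂ (a , u))) = power a (exponent k₁ k₂ u)
  decode (inj₂ (p , u , v))    = uncurry product (increasingPair n p) (exponent k₁ k₂ u) (exponent k₁ k₂ v)

  decode-surjective : ∀ {x : Term n} → Canonical k₁ k₂ x → ∃ λ c → decode c ≡ x
  decode-surjective {unit} _ = inj₁ (inj₁ zero) , refl
  decode-surjective {power a i} i∈I
    with u , refl ← exponent-surjective k₁ k₂ i∈I = inj₁ (inj₂ (a , u)) , refl
  decode-surjective {product a b i j} (a<b , i∈I , j∈I)
    with p , eq ← increasingPair-surjective a<b
       | u , refl ← exponent-surjective k₁ k₂ i∈I
       | v , refl ← exponent-surjective k₁ k₂ j∈I =
    inj₂ (p , u , v) , ≡.cong (λ ab → uncurry product ab (exponent k₁ k₂ u) (exponent k₁ k₂ v)) eq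

  enumerate : Fin (groupOrder k₁ k₂ n) → Term n
  enumerate = decode ∘ Inverse.to coordinate-↔

  enumerate-surjective : ∀ {x : Term n} → Canonical k₁ k₂ x → ∃ λ y → enumerate y ≡ x
  enumerate-surjective = to-preimage coordinate-↔ decode ∘ decode-surjective

module PowerLaws {c ℓ : Level} (G : AbelianGroup c ℓ) where
  open AbelianGroup G
    using (_≈_; _∙_; ε; _⁻¹; sym; trans; assoc; comm; identityˡ; identityʳ; inverseˡ; inverseʳ;
           ∙-congˡ; ∙-congʳ; ⁻¹-cong)
    renaming (refl to ≈-refl)
  open Powers G
  open import Algebra.Properties.AbelianGroup G using (⁻¹-∙-comm; xyx⁻¹≈y; inverseʳ-unique)
  open import Relation.Binary.Reasoning.Setoid (AbelianGroup.setoid G)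

  ^-suc : ∀ g x → g ^ (+ 1 + x) ≈ g ∙ g ^ x
  ^-suc g (+ _) = ≈-refl
  ^-suc g -[1+ 0 ] = begin
    ε             ≈⟨ inverseʳ g ⟨
    g ∙ g ⁻¹      ≈⟨ ∙-congˡ (⁻¹-cong (identityʳ g)) ⟨
    g ∙ (g ∙ ε) ⁻¹ ∎
  ^-suc g -[1+ suc q ] = begin
    (g ∙ powℕ g q) ⁻¹                ≈⟨ identityˡ _ ⟨
    ε ∙ (g ∙ powℕ g q) ⁻¹            ≈⟨ ∙-congʳ (inverseʳ g) ⟨
    (g ∙ g ⁻¹) ∙ (g ∙ powℕ g q) ⁻¹   ≈⟨ assoc _ _ _ ⟩
    g ∙ (g ⁻¹ ∙ (g ∙ powℕ g q) ⁻¹)   ≈⟨ ∙-congˡ (⁻¹-∙-comm _ _) ⟩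
    g ∙ (g ∙ (g ∙ powℕ g q)) ⁻¹      ∎

  ^-pred : ∀ g x → g ^ (-1ℤ + x) ≈ g ⁻¹ ∙ g ^ x
  ^-pred g (+ 0) = begin
    (g ∙ ε) ⁻¹ ≈⟨ ⁻¹-cong (identityʳ g) ⟩
    g ⁻¹       ≈⟨ identityʳ _ ⟨
    g ⁻¹ ∙ ε   ∎
  ^-pred g +[1+ p ] = begin
    powℕ g p              ≈⟨ identityˡ _ ⟨
    ε ∙ powℕ g p          ≈⟨ ∙-congʳ (inverseˡ g) ⟨
    (g ⁻¹ ∙ g) ∙ powℕ g p ≈⟨ assoc _ _ _ ⟩
    g ⁻¹ ∙ (g ∙ powℕ g p) ∎
  ^-pred g -[1+ q ] = sym (⁻¹-∙-comm _ _)

  ^-homo-+ : ∀ g x y → g ^ (x + y) ≈ g ^ x ∙ g ^ y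
  ^-homo-+ g (+ 0) y = begin
    g ^ (+ 0 + y) ≡⟨ ≡.cong (g ^_) (ℤ.+-identityˡ y) ⟩
    g ^ y         ≈⟨ identityˡ _ ⟨
    ε ∙ g ^ y     ∎
  ^-homo-+ g +[1+ p ] y = begin
    g ^ (+[1+ p ] + y)     ≡⟨ ≡.cong (g ^_) (ℤ.+-assoc (+ 1) (+ p) y) ⟩
    g ^ (+ 1 + (+ p + y))  ≈⟨ ^-suc g (+ p + y) ⟩
    g ∙ g ^ (+ p + y)      ≈⟨ ∙-congˡ (^-homo-+ g (+ p) y) ⟩
    g ∙ (powℕ g p ∙ g ^ y) ≈⟨ assoc _ _ _ ⟨
    (g ∙ powℕ g p) ∙ g ^ y ∎
  ^-homo-+ g -[1+ 0 ] y = begin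
    g ^ (-1ℤ + y)    ≈⟨ ^-pred g y ⟩
    g ⁻¹ ∙ g ^ y     ≈⟨ ∙-congʳ (⁻¹-cong (identityʳ g)) ⟨
    (g ∙ ε) ⁻¹ ∙ g ^ y ∎
  ^-homo-+ g -[1+ suc q ] y = begin
    g ^ (-[1+ suc q ] + y)                ≡⟨ ≡.cong (g ^_) (ℤ.+-assoc -1ℤ -[1+ q ] y) ⟩
    g ^ (-1ℤ + (-[1+ q ] + y))            ≈⟨ ^-pred g (-[1+ q ] + y) ⟩
    g ⁻¹ ∙ g ^ (-[1+ q ] + y)             ≈⟨ ∙-congˡ (^-homo-+ g -[1+ q ] y) ⟩
    g ⁻¹ ∙ ((g ∙ powℕ g q) ⁻¹ ∙ g ^ y)    ≈⟨ assoc _ _ _ ⟨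
    (g ⁻¹ ∙ (g ∙ powℕ g q) ⁻¹) ∙ g ^ y    ≈⟨ ∙-congʳ (⁻¹-∙-comm _ _) ⟩
    (g ∙ (g ∙ powℕ g q)) ⁻¹ ∙ g ^ y       ∎

  ^-neg : ∀ g x → g ^ (- x) ≈ (g ^ x) ⁻¹
  ^-neg g x = inverseʳ-unique (g ^ x) (g ^ (- x)) (begin
    g ^ x ∙ g ^ (- x) ≈⟨ ^-homo-+ g x (- x) ⟨
    g ^ (x - x)       ≡⟨ ≡.cong (g ^_) (ℤ.+-inverseʳ x) ⟩
    ε                 ∎)

  ^-shift : ∀ {g y} r → r + m ≡ p → g ^ m ≈ y → g ^ p ≈ g ^ r ∙ y
  ^-shift {m} {p} {g} {y} r r+m≡p gᵐ≈y = begin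
    g ^ p         ≡⟨ ≡.cong (g ^_) r+m≡p ⟨
    g ^ (r + m)   ≈⟨ ^-homo-+ g r m ⟩
    g ^ r ∙ g ^ m ≈⟨ ∙-congˡ gᵐ≈y ⟩
    g ^ r ∙ y     ∎

  ^-absorb : ∀ g r x y → g ^ r ∙ (g ^ x ∙ y) ≈ g ^ (r + x) ∙ y
  ^-absorb g r x y = trans (sym (assoc _ _ _)) (∙-congʳ (sym (^-homo-+ g r x)))

  cancel-middle : ∀ {x y z w} → x ≈ y ∙ (z ∙ w) → x ∙ z ⁻¹ ≈ y ∙ w
  cancel-middle {x} {y} {z} {w} x≈yzw = begin
    x ∙ z ⁻¹             ≈⟨ ∙-congʳ x≈yzw ⟩
    (y ∙ (z ∙ w)) ∙ z ⁻¹ ≈⟨ ∙-congʳ (trans (∙-congˡ (comm z w)) (sym (assoc _ _ _))) ⟩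
    ((y ∙ w) ∙ z) ∙ z ⁻¹ ≈⟨ ∙-congʳ (comm _ _) ⟩
    (z ∙ (y ∙ w)) ∙ z ⁻¹ ≈⟨ xyx⁻¹≈y z (y ∙ w) ⟩
    y ∙ w                ∎

module UniqueRepresentation {c ℓ : Level} (G : AbelianGroup c ℓ) {k₁ k₂ n : ℕ}
  (size : Bijection (setoid (Fin (groupOrder k₁ k₂ n))) (AbelianGroup.setoid G))
  (t : Fin n → AbelianGroup.Carrier G)
  (D : Code.IsDisjointUnion G t k₁ k₂) where

  open AbelianGroup G using (Carrier; _≈_; _∙_; ε; sym; trans; comm; identityˡ; ∙-congˡ)
    renaming (refl to ≈-refl)
  open Powers G
  open PowerLaws G
  open Code.IsDisjointUnion D
  open Coordinates k₁ k₂ n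

  eval : Term n → Carrier
  eval unit              = ε
  eval (power a i)       = t a ^ i
  eval (product a b i j) = t a ^ i ∙ t b ^ j

  eval-sortedProduct : ∀ a b i j → eval (sortedProduct a b i j) ≈ t a ^ i ∙ t b ^ j
  eval-sortedProduct a b i j with a Fin.<? b
  ... | yes _ = ≈-refl
  ... | no _  = comm _ _

  canonical⇒enumerated : ∀ {x g} → Canonical k₁ k₂ x → eval x ≈ g → ∃ λ y → eval (enumerate y) ≈ g
  canonical⇒enumerated cx ex≈g with y , refl ← enumerate-surjective cx = y , ex≈g

  eval∘enumerate-surjective : ∀ g → ∃ λ y → eval (enumerate y) ≈ g
  eval∘enumerate-surjective g with cover g
  ... | inj₁ g≈ε = canonical⇒enumerated {unit} tt (sym g≈ε)
  ... | inj₂ (inj₁ (a , i , i∈I , g≈aⁱ)) = canonical⇒enumerated {power a i} i∈I (sym g≈aⁱ)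
  ... | inj₂ (inj₂ (i , j , i∈I , j∈I , _ , a , b , a≢b , g≈aⁱbʲ)) =
    canonical⇒enumerated (sortedProduct-canonical a≢b i∈I j∈I)
      (trans (eval-sortedProduct a b i j) (sym g≈aⁱbʲ))

  canonical-unique : ∀ {x x′} → Canonical k₁ k₂ x → Canonical k₁ k₂ x′ → eval x ≈ eval x′ → x ≡ x′
  canonical-unique cx cx′ ex≈ex′
    with y , refl ← enumerate-surjective cx | y′ , refl ← enumerate-surjective cx′ =
    ≡.cong enumerate (surjective⇒injective (AbelianGroup.setoid G) size
                        (eval ∘ enumerate) eval∘enumerate-surjective {y} {y′} ex≈ex′)

  power-unique : ∀ {a b i j} → InI k₁ k₂ i → InI k₁ k₂ j → t a ^ i ≈ t b ^ j → a ≡ b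
  power-unique {a} {b} {i} {j} i∈I j∈I eq
    with refl ← canonical-unique {power a i} {power b j} i∈I j∈I eq = refl

  product-unique : ∀ {a b a′ b′ i j i′ j′} → a ≢ b → a′ ≢ b′ →
    InI k₁ k₂ i → InI k₁ k₂ j → InI k₁ k₂ i′ → InI k₁ k₂ j′ →
    t a ^ i ∙ t b ^ j ≈ t a′ ^ i′ ∙ t b′ ^ j′ →
    (a ≡ a′ × b ≡ b′ × i ≡ i′ × j ≡ j′) ⊎ (a ≡ b′ × b ≡ a′ × i ≡ j′ × j ≡ i′)
  product-unique {a} {b} {a′} {b′} {i} {j} {i′} {j′} a≢b a′≢b′ i∈I j∈I i′∈I j′∈I eq =
    sortedProduct-injective
      (canonical-unique (sortedProduct-canonical a≢b i∈I j∈I) (sortedProduct-canonical a′≢b′ i′∈I j′∈I)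
        (trans (eval-sortedProduct a b i j) (trans eq (sym (eval-sortedProduct a′ b′ i′ j′)))))

  power≉product : ∀ {a b c p i j} → a ≢ b → InI k₁ k₂ p → InI k₁ k₂ i → InI k₁ k₂ j →
    ¬ t c ^ p ≈ t a ^ i ∙ t b ^ j
  power≉product {a} {b} {c} {p} {i} {j} a≢b p∈I i∈I j∈I eq with i ℤ.≤? j
  ... | yes i≤j = T∩S c p i j p∈I i∈I j∈I i≤j (a , b , a≢b , eq)
  ... | no i≰j  = T∩S c p j i p∈I j∈I i∈I (ℤ.<⇒≤ (ℤ.≰⇒> i≰j)) (b , a , a≢b ∘ ≡.sym , trans eq (comm _ _))

  power≉power∙power : ∀ {a c p q j} → a ≢ c → InI k₁ k₂ p → q ∈[ - (+ k₂) , + k₁ ] → InI k₁ k₂ j →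
    ¬ t a ^ p ≈ t a ^ q ∙ t c ^ j
  power≉power∙power {q = q} a≢c p∈I q∈ j∈I eq with q ℤ.≟ + 0
  ... | yes refl = a≢c (power-unique p∈I j∈I (trans eq (identityˡ _)))
  ... | no q≢0   = power≉product a≢c p∈I (q≢0 , q∈) j∈I eq

  power∉S : ∀ {a b c m r i j} → b ≢ c → r + m ≡ + k₁ →
    InI k₁ k₂ (+ k₁) → InI k₁ k₂ r → InI k₁ k₂ i → InI k₁ k₂ (- i) → InI k₁ k₂ j →
    r + i ∈[ - (+ k₂) , + k₁ ] → r + j ∈[ - (+ k₂) , + k₁ ] →
    ¬ t a ^ m ≈ t b ^ i ∙ t c ^ j
  power∉S {a} {b} {c} {r = r} {i} {j} b≢c r+m≡k₁ k₁∈I r∈I i∈I -i∈I j∈I r+i∈ r+j∈ eq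
    with a Fin.≟ b | a Fin.≟ c
  ... | yes refl | _ =
    power≉power∙power b≢c k₁∈I r+i∈ j∈I
      (trans (^-shift r r+m≡k₁ eq) (^-absorb (t a) r i (t c ^ j)))
  ... | no a≢b | yes refl =
    power≉power∙power a≢b k₁∈I r+j∈ i∈I
      (trans (^-shift r r+m≡k₁ (trans eq (comm _ _))) (^-absorb (t a) r j (t b ^ i)))
  ... | no a≢b | no a≢c =
    [ b≢c ∘ proj₁ ∘ proj₂ , a≢c ∘ proj₁ ]
      (product-unique a≢b a≢c k₁∈I -i∈I r∈I j∈I
        (trans (∙-congˡ (^-neg (t b) i)) (cancel-middle (^-shift r r+m≡k₁ eq))))

lemma2p5 : {c ℓ : Level} (k₁ k₂ n : ℕ) → k₂ < k₁ → Composite (k₁ ℕ.+ k₂ ℕ.+ 1) →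
    (G : AbelianGroup c ℓ) →
    Bijection (setoid (Fin (groupOrder k₁ k₂ n))) (AbelianGroup.setoid G) →
    (t : Fin n → AbelianGroup.Carrier G) →
    (∀ a b → AbelianGroup._≈_ G (t a) (t b) → a ≡ b) →
    Code.IsDisjointUnion G t k₁ k₂ →
    ∀ (m i j : ℤ) →
    m ∈[ + (k₁ ℕ.+ 1) , + (k₁ ℕ.+ k₂) ]* →
    i ∈[ - (+ k₂) , + k₂ ]* →
    j ∈[ - (+ k₂) , + k₁ ]* →
    m - i ≤ + (k₁ ℕ.+ k₂) →
    m - j ≤ + (k₁ ℕ.+ k₂) →
    ∀ a → ¬ Code.InS G t i j (Powers._^_ G (t a) m)
lemma2p5 k₁ k₂ n k₂<k₁ _ G size t _ D m i j (_ , k₁+1≤m , m≤k₁+k₂) i∈ j∈@(_ , _ , j≤k₁) m-i≤ m-j≤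
  a (b , c , b≢c , eq) =
  UniqueRepresentation.power∉S G size t D b≢c ([k-m]+m≡k (+ k₁) m)
    (k₁∈I k₂<k₁) (k₁-m∈I k₁+1≤m m≤k₁+k₂) i∈I ([-k₂,k₂]*⊆I k₂<k₁ (neg-∈[-k,k]* i∈)) j∈
    ([k₁-m]+x∈[-k₂,k₁] (ℤ.≤-trans (proj₂ (proj₂ i∈I)) k₁≤m) m-i≤)
    ([k₁-m]+x∈[-k₂,k₁] (ℤ.≤-trans j≤k₁ k₁≤m) m-j≤)
    eq
  where
  [k-m]+m≡k : ∀ k m → (k - m) + m ≡ k
  [k-m]+m≡k = solve-∀

  i∈I : InI k₁ k₂ i
  i∈I = [-k₂,k₂]*⊆I k₂<k₁ i∈

  k₁≤m : + k₁ ≤ m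
  k₁≤m = ℤ.≤-trans (+≤+ (ℕ.m≤m+n k₁ 1)) k₁+1≤m
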